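{- Let $F$ be a closed relation on $2^\omega$ such that $\mathbb{B}_0\subseteq F\subseteq(N_0\times N_1)\cup(N_1\times N_0)$. (a) If $F$ is an Acyclic oriented graph, then there is an injective continuous $f:2^\omega\to2^\omega$ such that $(f\times f)[\mathbb{B}_0]\subseteq\mathbb{B}_0$, $(f\times f)[\overline{\mathbb{B}_0}\setminus\mathbb{B}_0]\subseteq\overline{\mathbb{B}_0}\setminus\mathbb{B}_0$ and $(f\times f)[\neg\overline{\mathbb{B}_0}]\subseteq\neg F$. (b) If $F$ is an acyclic graph, then there is an injective continuous $f:2^\omega\to2^\omega$ such that $(f\times f)[\mathbb{B}_0]\subseteq\mathbb{B}_0$, $(f\times f)[\overline{\mathbb{B}_0}\setminus\mathbb{B}_0]\subseteq\overline{\mathbb{B}_0}\setminus\mathbb{B}_0$ and $(f\times f)[\neg s(\overline{\mathbb{B}_0})]\subseteq\neg F$.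
   Context: $N_s:=\{\alpha\in2^\omega\mid s\subseteq\alpha\}$; $\neg$ denotes complement in $2^\omega\times2^\omega$; $\overline{E}$ is the closure; $s(E):=E\cup E^{ -1}$. Graph = irreflexive symmetric relation; oriented graph = irreflexive relation with $E\cap E^{ -1}$ contained in the diagonal. $E$ is acyclic if there is no injective sequence $(x_i)_{i\le n}$, $n\ge2$, with $(x_i,x_{i+1})\in E$ for $i<n$ and $(x_n,x_0)\in E$; Acyclic means $s(E)$ acyclic. Let $\psi:\omega\to2^{<\omega}$ list finite binary sequences by increasing length and lexicographically within each length, $s_n:=\psi(n)0^{n-|\psi(n)|}$, $\mathbb{G}_0:=\{(s_n0\gamma,s_n1\gamma)\mid n\in\omega,\gamma\in2^\omega\}$, $\mathbb{B}_0:=\{(0\alpha,1\beta)\mid(\alpha,\beta)\in\mathbb{G}_0\}$. -}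

module Defs where

open import Data.Bool using (Bool; true; false)
open import Data.Nat using (ℕ; zero; suc; _<_; _≤_; _∸_; _≡ᵇ_)
open import Data.Nat.DivMod using (_/_; _%_)
open import Data.List using (List; []; _∷_; _++_; length; reverse; drop; replicate; lookup)
open import Data.Fin using (Fin; inject₁; fromℕ; fromℕ<) renaming (zero to fzero; suc to fsuc)
open import Data.Product using (Σ; ∃; _×_; _,_)
open import Data.Sum using (_⊎_)
open import Relation.Nullary using (¬_)
open import Relation.Binary.PropositionalEquality using (_≡_)
open import Level using (0ℓ)
open import Axiom.ExcludedMiddle using (ExcludedMiddle) public

-- Cantor space 2^ω, with 0 = false, 1 = true.
Cantor : Set
Cantor = ℕ → Bool

_≈_ : Cantor → Cantor → Set
x ≈ y = ∀ i → x i ≡ y i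

Rel : Set₁
Rel = Cantor → Cantor → Set

Agree : ℕ → Cantor → Cantor → Set
Agree n x y = ∀ i → i < n → x i ≡ y i

N : List Bool → Cantor → Set
N s x = (i : Fin (length s)) → x (Data.Fin.toℕ i) ≡ lookup s i

prepend : List Bool → Cantor → Cantor
prepend []      γ i       = γ i
prepend (b ∷ s) γ zero    = b
prepend (b ∷ s) γ (suc i) = prepend s γ i

-- little-endian binary digits of m (fuel-bounded; fuel m suffices)
lsbBits : ℕ → ℕ → List Bool
lsbBits zero     m = []
lsbBits (suc f) m with m ≡ᵇ 0
... | true  = []
... | false = (m % 2 ≡ᵇ 1) ∷ lsbBits f (m / 2)

-- ψ(n): the n-th finite binary sequence, ordered by length and then
-- lexicographically; it is the binary expansion of n+1 with its leading 1 removed.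
ψ : ℕ → List Bool
ψ n = drop 1 (reverse (lsbBits (suc n) (suc n)))

sₙ : ℕ → List Bool
sₙ n = ψ n ++ replicate (n ∸ length (ψ n)) false

𝔾₀ : Rel
𝔾₀ x y = Σ ℕ λ n → Σ Cantor λ γ →
  (x ≈ prepend (sₙ n ++ (false ∷ [])) γ) × (y ≈ prepend (sₙ n ++ (true ∷ [])) γ)

𝔹₀ : Rel
𝔹₀ x y = Σ Cantor λ α → Σ Cantor λ β →
  𝔾₀ α β × (x ≈ prepend (false ∷ []) α) × (y ≈ prepend (true ∷ []) β)

_⊆_ : Rel → Rel → Set
E ⊆ F = ∀ x y → E x y → F x y

_∪_ : Rel → Rel → Rel
(E ∪ F) x y = E x y ⊎ F x y

_∖_ : Rel → Rel → Rel
(E ∖ F) x y = E x y × ¬ F x y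

∁ : Rel → Rel
∁ E x y = ¬ E x y

_⁻¹ : Rel → Rel
(E ⁻¹) x y = E y x

sym : Rel → Rel
sym E = E ∪ (E ⁻¹)

_⊠_ : (Cantor → Set) → (Cantor → Set) → Rel
(A ⊠ B) x y = A x × B y

closure : Rel → Rel
closure E x y = ∀ n → Σ Cantor λ x' → Σ Cantor λ y' → E x' y' × Agree n x x' × Agree n y y'

Closed : Rel → Set
Closed E = ∀ x y → ¬ E x y → Σ ℕ λ n → ∀ x' y' → Agree n x x' → Agree n y y' → ¬ E x' y'

MapsInto : (Cantor → Cantor) → Rel → Rel → Set
MapsInto f A B = ∀ x y → A x y → B (f x) (f y)

Injective : (Cantor → Cantor) → Set
Injective f = ∀ x y → f x ≈ f y → x ≈ y

Continuous : (Cantor → Cantor) → Set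
Continuous f = ∀ x n → Σ ℕ λ m → ∀ y → Agree m x y → Agree n (f x) (f y)

Irreflexive : Rel → Set
Irreflexive E = ∀ x → ¬ E x x

IsGraph : Rel → Set
IsGraph E = Irreflexive E × (∀ x y → E x y → E y x)

IsOrientedGraph : Rel → Set
IsOrientedGraph E = Irreflexive E × (∀ x y → E x y → E y x → x ≈ y)

Cycle : Rel → Set
Cycle E = Σ ℕ λ n → Σ (Fin (suc n) → Cantor) λ xs →
  (2 ≤ n) ×
  (∀ i j → xs i ≈ xs j → i ≡ j) ×
  (∀ (i : Fin n) → E (xs (inject₁ i)) (xs (fsuc i))) ×
  E (xs (fromℕ n)) (xs fzero)

acyclic : Rel → Set
acyclic E = ¬ Cycle E

Acyclic : Rel → Set
Acyclic E = acyclic (sym E)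

N0 N1 : Cantor → Set
N0 = N (false ∷ [])
N1 = N (true ∷ [])

-- Let H be s(F) in part (a) and F in part (b): a closed, symmetric, acyclic relation that
-- contains 𝔹₀ and hence, being closed, every pair (0γ, 1γ).  These pairs and 𝔹₀ join any two
-- eventually equal points by an injective path, so acyclicity of H allows an H-edge (0α, 1β)
-- between eventually equal α, β only if α = β or (α, β) ∈ 𝔾₀.
--
-- The embedding is f(iα) = i g(α), where g(α) carries α(j) to coordinate π(j) and is 0
-- elsewhere.  The coordinates π(0) < π(1) < ⋯ are chosen so that s_{π(k)} is the image of s_k
-- under g followed by zeros; hence g preserves and reflects 𝔾₀.  The number of zeros is so large
-- that, by closedness of H, every non-edge between (eventually zero) images of words of length k
-- survives all extensions.  If α and β differ in two places below k, those images are not an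
-- H-edge by the first paragraph, hence neither is (0g(α), 1g(β)); if they differ in at most one
-- place, g(α) and g(β) are eventually equal and the first paragraph applies directly.  So
-- H(f x, f y) with x(0) = 0, y(0) = 1 puts (x, y) into the closure of 𝔹₀, and both parts follow
-- from F ⊆ (N₀ × N₁) ∪ (N₁ × N₀), using antisymmetry of F in part (a).

module Submission where

open import Defs
open import Data.Bool using (Bool; true; false; not)
open import Data.Maybe using (Maybe; just; nothing; maybe′)
open import Data.Bool.Properties using (_≟_; ¬-not; not-¬)
open import Data.Nat using (ℕ; zero; suc; compare; less; equal; greater; _+_; _*_; _∸_; _<_; _≤_; _⊔_; _≡ᵇ_; z≤n; s≤s; s≤s⁻¹)
open import Data.Nat.Properties
  using ( ≤-refl; ≤-trans; <-trans; <-≤-trans; <-irrefl; <-asym; <-cmp; <⇒≢; <⇒≤; n<1+n; n≤1+n; m<n⇒m<1+n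
        ; m≤m+n; m≤n+m; m≤m*n; m≤m⊔n; m≤n⊔m; *-monoˡ-≤; ∸-monoˡ-≤; +-identityʳ; +-suc; m+[n∸m]≡n
        ; m≤n⇒m<n∨m≡n; m≤n⇒∃[o]m+o≡n; _<?_; module ≤-Reasoning )
  renaming (_≟_ to _≟ℕ_)
open import Data.Nat.DivMod using (_/_; _%_; m*n/n≡m; m*n%n≡0; +-distrib-/; [m+kn]%n≡m%n)
open import Data.List using (List; []; _∷_; _++_; _∷ʳ_; length; reverse; drop; replicate)
open import Data.List.Properties using (length-++; length-replicate; length-reverse; length-drop; reverse-++; reverse-involutive)
open import Data.Fin using (Fin; fromℕ; inject₁) renaming (zero to fzero; suc to fsuc)
open import Data.Unit using (⊤; tt)
open import Data.Empty using (⊥-elim)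
open import Data.Product using (Σ; _×_; _,_; proj₁; proj₂; map₁)
open import Data.Sum using (_⊎_; inj₁; inj₂; swap)
open import Level using (0ℓ)
open import Relation.Binary.PropositionalEquality
  using (_≡_; refl; cong; cong₂; trans; subst; subst₂; _≢_; ≢-sym; module ≡-Reasoning) renaming (sym to ≡-sym)
open import Function using (_∘_)
open import Relation.Binary.Definitions using (tri<; tri≈; tri>)
open import Relation.Nullary using (¬_; yes; no; contradiction)
open import Relation.Nullary.Decidable using (decidable-stable)

zeros : Cantor
zeros _ = false

cons : Bool → Cantor → Cantor
cons b x = prepend (b ∷ []) x

tail : Cantor → Cantor
tail x i = x (suc i)

prefix : ℕ → Cantor → List Bool
prefix zero    x = []
prefix (suc n) x = x 0 ∷ prefix n (tail x)

pad : List Bool → Cantor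
pad w = prepend w zeros

AgreeFrom : ℕ → Cantor → Cantor → Set
AgreeFrom n x y = ∀ i → n ≤ i → x i ≡ y i

length-prefix : ∀ n x → length (prefix n x) ≡ n
length-prefix zero    x = refl
length-prefix (suc n) x = cong suc (length-prefix n (tail x))

prepend-prefix : ∀ n x γ {i} → i < n → prepend (prefix n x) γ i ≡ x i
prepend-prefix (suc n) x γ {zero}  _         = refl
prepend-prefix (suc n) x γ {suc i} (s≤s i<n) = prepend-prefix n (tail x) γ i<n

prefix-cong : ∀ n {x y} → x ≈ y → prefix n x ≡ prefix n y
prefix-cong zero    x≈y = refl
prefix-cong (suc n) x≈y = cong₂ _∷_ (x≈y 0) (prefix-cong n (λ i → x≈y (suc i)))

prepend-++ : ∀ u v γ i → prepend (u ++ v) γ i ≡ prepend u (prepend v γ) i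
prepend-++ []      v γ i       = refl
prepend-++ (b ∷ u) v γ zero    = refl
prepend-++ (b ∷ u) v γ (suc i) = prepend-++ u v γ i

prepend-< : ∀ w γ γ′ {i} → i < length w → prepend w γ i ≡ prepend w γ′ i
prepend-< (b ∷ w) γ γ′ {zero}  _         = refl
prepend-< (b ∷ w) γ γ′ {suc i} (s≤s i<n) = prepend-< w γ γ′ i<n

prepend-+ : ∀ w γ j → prepend w γ (length w + j) ≡ γ j
prepend-+ []      γ j = refl
prepend-+ (b ∷ w) γ j = prepend-+ w γ j

pad-replicate : ∀ n i → pad (replicate n false) i ≡ false
pad-replicate zero    i       = refl
pad-replicate (suc n) zero    = refl
pad-replicate (suc n) (suc i) = pad-replicate n i

pad-++-zeros : ∀ w n → pad (w ++ replicate n false) ≈ pad w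
pad-++-zeros []      n i       = pad-replicate n i
pad-++-zeros (b ∷ w) n zero    = refl
pad-++-zeros (b ∷ w) n (suc i) = pad-++-zeros w n i

pad-prefix : ∀ n x → AgreeFrom n x zeros → pad (prefix n x) ≈ x
pad-prefix zero    x x≡zeros i       = ≡-sym (x≡zeros i z≤n)
pad-prefix (suc n) x x≡zeros zero    = refl
pad-prefix (suc n) x x≡zeros (suc i) = pad-prefix n (tail x) (λ j n≤j → x≡zeros (suc j) (s≤s n≤j)) i

bit : Bool → ℕ
bit false = 0
bit true  = 1

fromBits : List Bool → ℕ
fromBits []      = 0
fromBits (b ∷ w) = bit b + fromBits w * 2

bit+v*2/2≡v : ∀ b v → (bit b + v * 2) / 2 ≡ v
bit+v*2/2≡v false v = m*n/n≡m v 2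
bit+v*2/2≡v true  v = trans (+-distrib-/ 1 (v * 2) (subst (λ r → 1 + r < 2) (≡-sym (m*n%n≡0 v 2)) ≤-refl)) (m*n/n≡m v 2)

bit+v*2-parity : ∀ b v → ((bit b + v * 2) % 2 ≡ᵇ 1) ≡ b
bit+v*2-parity b v = trans (cong (_≡ᵇ 1) ([m+kn]%n≡m%n (bit b) v 2)) (odd-bit b)
  where
  odd-bit : ∀ b → (bit b % 2 ≡ᵇ 1) ≡ b
  odd-bit false = refl
  odd-bit true  = refl

fromBits-∷ʳtrue-positive : ∀ w → 1 ≤ fromBits (w ∷ʳ true)
fromBits-∷ʳtrue-positive []      = s≤s z≤n
fromBits-∷ʳtrue-positive (b ∷ w) =
  ≤-trans (≤-trans (s≤s z≤n) (*-monoˡ-≤ 2 (fromBits-∷ʳtrue-positive w))) (m≤n+m _ (bit b))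

length≤fromBits-∷ʳtrue : ∀ w → length (w ∷ʳ true) ≤ fromBits (w ∷ʳ true)
length≤fromBits-∷ʳtrue []      = s≤s z≤n
length≤fromBits-∷ʳtrue (b ∷ w) =
  ≤-trans (s≤s (length≤fromBits-∷ʳtrue w)) (≤-trans (n+1≤2n (fromBits-∷ʳtrue-positive w)) (m≤n+m _ (bit b)))
  where
  n+1≤2n : ∀ {n} → 1 ≤ n → suc n ≤ n * 2
  n+1≤2n {suc n} _ = s≤s (s≤s (m≤m*n n 2))

lsbBits-zero : ∀ fuel → lsbBits fuel 0 ≡ []
lsbBits-zero zero       = refl
lsbBits-zero (suc fuel) = refl

lsbBits-step : ∀ b v fuel → 1 ≤ v → lsbBits (suc fuel) (bit b + v * 2) ≡ b ∷ lsbBits fuel v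
lsbBits-step false (suc v) fuel _ = cong₂ _∷_ (bit+v*2-parity false (suc v)) (cong (lsbBits fuel) (bit+v*2/2≡v false (suc v)))
lsbBits-step true  (suc v) fuel _ = cong₂ _∷_ (bit+v*2-parity true (suc v)) (cong (lsbBits fuel) (bit+v*2/2≡v true (suc v)))

lsbBits-fromBits : ∀ w fuel → length (w ∷ʳ true) ≤ fuel → lsbBits fuel (fromBits (w ∷ʳ true)) ≡ w ∷ʳ true
lsbBits-fromBits []      (suc fuel) _              = cong (true ∷_) (lsbBits-zero fuel)
lsbBits-fromBits (b ∷ w) (suc fuel) (s≤s len≤fuel) =
  trans (lsbBits-step b _ fuel (fromBits-∷ʳtrue-positive w)) (cong (b ∷_) (lsbBits-fromBits w fuel len≤fuel))

-- fromBits is little-endian, so fromBits (reverse w ∷ʳ true) is the number written 1w in binary.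
ψ⁻¹ : List Bool → ℕ
ψ⁻¹ w = fromBits (reverse w ∷ʳ true) ∸ 1

ψ-ψ⁻¹ : ∀ w → ψ (ψ⁻¹ w) ≡ w
ψ-ψ⁻¹ w = begin
  drop 1 (reverse (lsbBits (suc (ψ⁻¹ w)) (suc (ψ⁻¹ w))))
    ≡⟨ cong (λ m → drop 1 (reverse (lsbBits m m))) (m+[n∸m]≡n (fromBits-∷ʳtrue-positive (reverse w))) ⟩
  drop 1 (reverse (lsbBits value value))
    ≡⟨ cong (drop 1 ∘ reverse) (lsbBits-fromBits (reverse w) value (length≤fromBits-∷ʳtrue (reverse w))) ⟩
  drop 1 (reverse (reverse w ∷ʳ true))
    ≡⟨ cong (drop 1) (reverse-++ (reverse w) (true ∷ [])) ⟩
  reverse (reverse w)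
    ≡⟨ reverse-involutive w ⟩
  w ∎
  where
  open ≡-Reasoning
  value = fromBits (reverse w ∷ʳ true)

length-lsbBits : ∀ fuel m → length (lsbBits fuel m) ≤ fuel
length-lsbBits zero       m = z≤n
length-lsbBits (suc fuel) m with m ≡ᵇ 0
... | true  = z≤n
... | false = s≤s (length-lsbBits fuel (m / 2))

length-ψ : ∀ n → length (ψ n) ≤ n
length-ψ n = begin
  length (ψ n)               ≡⟨ length-drop 1 (reverse bits) ⟩
  length (reverse bits) ∸ 1  ≡⟨ cong (_∸ 1) (length-reverse bits) ⟩
  length bits ∸ 1            ≤⟨ ∸-monoˡ-≤ 1 (length-lsbBits (suc n) (suc n)) ⟩
  n                          ∎
  where
  open ≤-Reasoning
  bits = lsbBits (suc n) (suc n)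

length-sₙ : ∀ n → length (sₙ n) ≡ n
length-sₙ n = begin
  length (ψ n ++ replicate (n ∸ length (ψ n)) false)         ≡⟨ length-++ (ψ n) ⟩
  length (ψ n) + length (replicate (n ∸ length (ψ n)) false)  ≡⟨ cong (length (ψ n) +_) (length-replicate (n ∸ length (ψ n))) ⟩
  length (ψ n) + (n ∸ length (ψ n))                           ≡⟨ m+[n∸m]≡n (length-ψ n) ⟩
  n                                                           ∎
  where open ≡-Reasoning

≈-refl : ∀ {x} → x ≈ x
≈-refl i = refl

≈-sym : ∀ {x y} → x ≈ y → y ≈ x
≈-sym x≈y i = ≡-sym (x≈y i)

≈-trans : ∀ {x y z} → x ≈ y → y ≈ z → x ≈ z
≈-trans x≈y y≈z i = trans (x≈y i) (y≈z i)

cons-cong : ∀ {a b x y} → a ≡ b → x ≈ y → cons a x ≈ cons b y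
cons-cong a≡b x≈y zero    = a≡b
cons-cong a≡b x≈y (suc i) = x≈y i

tail-cong : ∀ {x y} → x ≈ y → tail x ≈ tail y
tail-cong x≈y i = x≈y (suc i)

cons-tail : ∀ {b x} → x 0 ≡ b → x ≈ cons b (tail x)
cons-tail x0≡b zero    = x0≡b
cons-tail x0≡b (suc i) = refl

ŝ : ℕ → Cantor
ŝ n = pad (sₙ n)

ŝ-ψ⁻¹ : ∀ w → ŝ (ψ⁻¹ w) ≈ pad w
ŝ-ψ⁻¹ w i = trans (pad-++-zeros (ψ (ψ⁻¹ w)) _ i) (cong (λ u → pad u i) (ψ-ψ⁻¹ w))

length≤ψ⁻¹ : ∀ w → length w ≤ ψ⁻¹ w
length≤ψ⁻¹ w = subst (λ u → length u ≤ ψ⁻¹ w) (ψ-ψ⁻¹ w) (length-ψ (ψ⁻¹ w))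

ŝ-dense : ∀ n x → Σ ℕ λ m → n ≤ m × Agree n (ŝ m) x
ŝ-dense n x = ψ⁻¹ (prefix n x)
            , subst (_≤ ψ⁻¹ (prefix n x)) (length-prefix n x) (length≤ψ⁻¹ (prefix n x))
            , λ i i<n → trans (ŝ-ψ⁻¹ (prefix n x) i) (prepend-prefix n x zeros i<n)

branch : ℕ → Bool → Cantor → Cantor
branch n b γ = prepend (sₙ n ++ (b ∷ [])) γ

branch-< : ∀ n b γ {i} → i < n → branch n b γ i ≡ ŝ n i
branch-< n b γ {i} i<n =
  trans (prepend-++ (sₙ n) _ γ i) (prepend-< (sₙ n) _ zeros (subst (i <_) (≡-sym (length-sₙ n)) i<n))

branch-+ : ∀ n b γ j → branch n b γ (n + j) ≡ cons b γ j
branch-+ n b γ j = begin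
  branch n b γ (n + j)                           ≡⟨ prepend-++ (sₙ n) (b ∷ []) γ (n + j) ⟩
  prepend (sₙ n) (cons b γ) (n + j)              ≡⟨ cong (λ m → prepend (sₙ n) (cons b γ) (m + j)) (≡-sym (length-sₙ n)) ⟩
  prepend (sₙ n) (cons b γ) (length (sₙ n) + j)  ≡⟨ prepend-+ (sₙ n) (cons b γ) j ⟩
  cons b γ j                                     ∎
  where open ≡-Reasoning

branch-at : ∀ n b γ → branch n b γ n ≡ b
branch-at n b γ = trans (cong (branch n b γ) (≡-sym (+-identityʳ n))) (branch-+ n b γ 0)

branch-> : ∀ n b γ k → branch n b γ (suc (n + k)) ≡ γ k
branch-> n b γ k = trans (cong (branch n b γ) (≡-sym (+-suc n k))) (branch-+ n b γ (suc k))

𝔾₀-branch : ∀ n γ → 𝔾₀ (branch n false γ) (branch n true γ)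
𝔾₀-branch n γ = n , γ , ≈-refl , ≈-refl

𝔾₀-resp : ∀ {x y x′ y′} → x ≈ x′ → y ≈ y′ → 𝔾₀ x y → 𝔾₀ x′ y′
𝔾₀-resp x≈x′ y≈y′ (n , γ , x≈ , y≈) = n , γ , ≈-trans (≈-sym x≈x′) x≈ , ≈-trans (≈-sym y≈y′) y≈

record 𝔾₀-at (n : ℕ) (x y : Cantor) : Set where
  field
    left-bit  : x n ≡ false
    right-bit : y n ≡ true
    agree-off : ∀ i → i ≢ n → x i ≡ y i
    below     : Agree n x (ŝ n)

𝔾₀-at-difference : ∀ {n x y i} → 𝔾₀-at n x y → x i ≢ y i → i ≡ n
𝔾₀-at-difference {n} {i = i} G xi≢yi with i ≟ℕ n
... | yes i≡n = i≡n
... | no  i≢n = contradiction (𝔾₀-at.agree-off G i i≢n) xi≢yi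

𝔾₀⇒𝔾₀-at : ∀ {x y} → 𝔾₀ x y → Σ ℕ λ n → 𝔾₀-at n x y
𝔾₀⇒𝔾₀-at {x} {y} (n , γ , x≈ , y≈) = n , record
  { left-bit  = trans (x≈ n) (branch-at n false γ)
  ; right-bit = trans (y≈ n) (branch-at n true γ)
  ; agree-off = agree-off
  ; below     = λ i i<n → trans (x≈ i) (branch-< n false γ i<n)
  }
  where
  agree-off : ∀ i → i ≢ n → x i ≡ y i
  agree-off i i≢n with compare i n
  ... | less .i k    = trans (x≈ i) (trans (branch-< _ false γ i<n) (≡-sym (trans (y≈ i) (branch-< _ true γ i<n))))
    where i<n = s≤s (m≤m+n i k)
  ... | equal .i     = contradiction refl i≢n
  ... | greater .n k = trans (x≈ _) (trans (branch-> n false γ k) (≡-sym (trans (y≈ _) (branch-> n true γ k))))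

𝔾₀-at⇒𝔾₀ : ∀ {n x y} → 𝔾₀-at n x y → 𝔾₀ x y
𝔾₀-at⇒𝔾₀ {n} {x} {y} G = n , γ , x≈ , y≈
  where
  open 𝔾₀-at G
  γ : Cantor
  γ k = x (suc (n + k))
  x≈ : x ≈ branch n false γ
  x≈ i with compare i n
  ... | less .i k    = trans (below i i<n) (≡-sym (branch-< _ false γ i<n))
    where i<n = s≤s (m≤m+n i k)
  ... | equal .i     = trans left-bit (≡-sym (branch-at n false γ))
  ... | greater .n k = ≡-sym (branch-> n false γ k)
  y≈ : y ≈ branch n true γ
  y≈ i with compare i n
  ... | less .i k    = trans (≡-sym (agree-off i (<⇒≢ i<n))) (trans (below i i<n) (≡-sym (branch-< _ true γ i<n)))
    where i<n = s≤s (m≤m+n i k)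
  ... | equal .i     = trans right-bit (≡-sym (branch-at n true γ))
  ... | greater .n k = trans (≡-sym (agree-off _ (≢-sym (<⇒≢ (s≤s (m≤m+n n k)))))) (≡-sym (branch-> n true γ k))

Across : Rel → Rel
Across E x y = x 0 ≡ false × y 0 ≡ true × E (tail x) (tail y)

𝔹₀⇒Across : 𝔹₀ ⊆ Across 𝔾₀
𝔹₀⇒Across x y (α , β , G , x≈ , y≈) = x≈ 0 , y≈ 0 , 𝔾₀-resp (≈-sym (tail-cong x≈)) (≈-sym (tail-cong y≈)) G

Across⇒𝔹₀ : Across 𝔾₀ ⊆ 𝔹₀
Across⇒𝔹₀ x y (x0 , y0 , G) = tail x , tail y , G , cons-tail x0 , cons-tail y0

𝔾₀ᵣ : Rel
𝔾₀ᵣ x y = x ≈ y ⊎ 𝔾₀ x y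

𝔾₀ᵣ-resp : ∀ {x y x′ y′} → x ≈ x′ → y ≈ y′ → 𝔾₀ᵣ x y → 𝔾₀ᵣ x′ y′
𝔾₀ᵣ-resp x≈x′ y≈y′ (inj₁ x≈y) = inj₁ (≈-trans (≈-sym x≈x′) (≈-trans x≈y y≈y′))
𝔾₀ᵣ-resp x≈x′ y≈y′ (inj₂ G)   = inj₂ (𝔾₀-resp x≈x′ y≈y′ G)

Link : Rel
Link = Across 𝔾₀ᵣ

sym-Link-respˡ : ∀ {x x′ y} → x ≈ x′ → sym Link x′ y → sym Link x y
sym-Link-respˡ x≈x′ (inj₁ (x0 , y0 , r)) = inj₁ (trans (x≈x′ 0) x0 , y0 , 𝔾₀ᵣ-resp (≈-sym (tail-cong x≈x′)) ≈-refl r)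
sym-Link-respˡ x≈x′ (inj₂ (y0 , x0 , r)) = inj₂ (y0 , trans (x≈x′ 0) x0 , 𝔾₀ᵣ-resp ≈-refl (≈-sym (tail-cong x≈x′)) r)

Agree-mono : ∀ {m n x y} → m ≤ n → Agree n x y → Agree m x y
Agree-mono m≤n x≈y i i<m = x≈y i (<-≤-trans i<m m≤n)

≈⇒Agree : ∀ {x y} n → x ≈ y → Agree n x y
≈⇒Agree n x≈y i _ = x≈y i

Agree-cons : ∀ {n x y} b → Agree n x y → Agree (suc n) (cons b x) (cons b y)
Agree-cons b x≈y zero    _         = refl
Agree-cons b x≈y (suc i) (s≤s i<n) = x≈y i i<n

⊆closure : ∀ E → E ⊆ closure E
⊆closure E x y e n = x , y , e , (λ _ _ → refl) , (λ _ _ → refl)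

diagonal⊆closure-𝔹₀ : ∀ x y → x 0 ≡ false → y 0 ≡ true → tail x ≈ tail y → closure 𝔹₀ x y
diagonal⊆closure-𝔹₀ x y x0 y0 tx≈ty n with ŝ-dense n (tail x)
... | m , n≤m , ŝm≈x = cons false (branch m false zeros) , cons true (branch m true zeros)
                     , Across⇒𝔹₀ _ _ (refl , refl , 𝔾₀-branch m zeros)
                     , agree x0 ≈-refl , agree y0 tx≈ty
  where
  agree : ∀ {b z} → z 0 ≡ b → tail x ≈ tail z → Agree n z (cons b (branch m b zeros))
  agree z0 tx≈tz zero    _   = z0
  agree z0 tx≈tz (suc i) 1+i<n =
    trans (≡-sym (tx≈tz i)) (trans (≡-sym (ŝm≈x i i<n)) (≡-sym (branch-< m _ zeros (<-≤-trans i<n n≤m))))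
    where i<n = <-trans (n<1+n i) 1+i<n

Link⊆closure-𝔹₀ : Link ⊆ closure 𝔹₀
Link⊆closure-𝔹₀ x y (x0 , y0 , inj₁ tx≈ty) = diagonal⊆closure-𝔹₀ x y x0 y0 tx≈ty
Link⊆closure-𝔹₀ x y (x0 , y0 , inj₂ G)     = ⊆closure 𝔹₀ x y (Across⇒𝔹₀ x y (x0 , y0 , G))

closed-sym : ∀ {F} → Closed F → Closed (sym F)
closed-sym {F} F-closed x y ¬Fxy with F-closed x y (¬Fxy ∘ inj₁) | F-closed y x (¬Fxy ∘ inj₂)
... | m , ¬F₁ | n , ¬F₂ = m ⊔ n , ¬sym
  where
  ¬sym : ∀ x′ y′ → Agree (m ⊔ n) x x′ → Agree (m ⊔ n) y y′ → ¬ sym F x′ y′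
  ¬sym x′ y′ x≈ y≈ (inj₁ F′) = ¬F₁ x′ y′ (Agree-mono (m≤m⊔n m n) x≈) (Agree-mono (m≤m⊔n m n) y≈) F′
  ¬sym x′ y′ x≈ y≈ (inj₂ F′) = ¬F₂ y′ x′ (Agree-mono (m≤n⊔m m n) y≈) (Agree-mono (m≤n⊔m m n) x≈) F′

module _ (em : ExcludedMiddle 0ℓ) {F : Rel} (F-closed : Closed F) where

  closure⊆closed : ∀ {E} → E ⊆ F → closure E ⊆ F
  closure⊆closed E⊆F x y x̄ȳ with em {F x y}
  ... | yes Fxy = Fxy
  ... | no ¬Fxy with F-closed x y ¬Fxy
  ... | n , ¬F with x̄ȳ n
  ... | x′ , y′ , e , x≈ , y≈ = contradiction (E⊆F x′ y′ e) (¬F x′ y′ x≈ y≈)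

  closed-resp : ∀ {x y x′ y′} → x ≈ x′ → y ≈ y′ → F x y → F x′ y′
  closed-resp {x} {y} {x′} {y′} x≈x′ y≈y′ Fxy with em {F x′ y′}
  ... | yes Fx′y′ = Fx′y′
  ... | no ¬Fx′y′ with F-closed x′ y′ ¬Fx′y′
  ... | n , ¬F = contradiction Fxy (¬F x y (≈⇒Agree n (≈-sym x≈x′)) (≈⇒Agree n (≈-sym y≈y′)))

  radius : Cantor → Cantor → ℕ
  radius x y with em {¬ F x y}
  ... | yes ¬Fxy = proj₁ (F-closed x y ¬Fxy)
  ... | no  _    = 0

  radius-isolates : ∀ {x y} → ¬ F x y → ∀ x′ y′ → Agree (radius x y) x x′ → Agree (radius x y) y y′ → ¬ F x′ y′
  radius-isolates {x} {y} ¬Fxy with em {¬ F x y}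
  ... | yes ¬Fxy′ = proj₂ (F-closed x y ¬Fxy′)
  ... | no  ¬¬Fxy = contradiction ¬Fxy ¬¬Fxy

infixr 5 _◅_

data Walk (E : Rel) : Cantor → Set where
  stop : ∀ {x} → Walk E x
  _◅_  : ∀ {x y} → E x y → Walk E y → Walk E x

module _ {E : Rel} where

  end : ∀ {x} → Walk E x → Cantor
  end (stop {x}) = x
  end (_ ◅ p)    = end p

  steps : ∀ {x} → Walk E x → ℕ
  steps stop    = 0
  steps (_ ◅ p) = suc (steps p)

  vertex : ∀ {x} (p : Walk E x) → Fin (suc (steps p)) → Cantor
  vertex (stop {x})    _        = x
  vertex (_◅_ {x} _ p) fzero    = x
  vertex (_ ◅ p)       (fsuc i) = vertex p i

  AllVertices : (Cantor → Set) → ∀ {x} → Walk E x → Set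
  AllVertices P (stop {x})    = P x
  AllVertices P (_◅_ {x} _ p) = P x × AllVertices P p

  Distinct : ∀ {x} → Walk E x → Set
  Distinct stop          = ⊤
  Distinct (_◅_ {x} _ p) = AllVertices (λ y → ¬ x ≈ y) p × Distinct p

  join : ∀ {x y} (p : Walk E x) → E (end p) y → Walk E y → Walk E x
  join stop    e q = e ◅ q
  join (e′ ◅ p) e q = e′ ◅ join p e q

  end-join : ∀ {x y} (p : Walk E x) (e : E (end p) y) (q : Walk E y) → end (join p e q) ≡ end q
  end-join stop     e q = refl
  end-join (_ ◅ p)  e q = end-join p e q

  All-map : ∀ {P Q : Cantor → Set} {x} (p : Walk E x) → (∀ {y} → P y → Q y) → AllVertices P p → AllVertices Q p
  All-map stop    f Px         = f Px
  All-map (_ ◅ p) f (Px , Pp)  = f Px , All-map p f Pp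

  All-join : ∀ {P x y} (p : Walk E x) (e : E (end p) y) (q : Walk E y) →
             AllVertices P p → AllVertices P q → AllVertices P (join p e q)
  All-join stop    e q Px        Pq = Px , Pq
  All-join (_ ◅ p) e q (Px , Pp) Pq = Px , All-join p e q Pp Pq

  Distinct-join : ∀ {x y} (p : Walk E x) (e : E (end p) y) (q : Walk E y) → Distinct p → Distinct q →
                  AllVertices (λ u → AllVertices (λ v → ¬ u ≈ v) q) p → Distinct (join p e q)
  Distinct-join stop    e q _         q-distinct sep         = sep , q-distinct
  Distinct-join (_ ◅ p) e q (new , d) q-distinct (sep , sep′) =
    All-join p e q new sep , Distinct-join p e q d q-distinct sep′

  vertex-All : ∀ {P x} (p : Walk E x) → AllVertices P p → ∀ i → P (vertex p i)
  vertex-All stop    Px        _        = Px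
  vertex-All (_ ◅ p) (Px , _)  fzero    = Px
  vertex-All (_ ◅ p) (_ , Pp)  (fsuc i) = vertex-All p Pp i

  vertex-injective : ∀ {x} (p : Walk E x) → Distinct p → ∀ i j → vertex p i ≈ vertex p j → i ≡ j
  vertex-injective stop    _          fzero    fzero    _   = refl
  vertex-injective (_ ◅ p) _          fzero    fzero    _   = refl
  vertex-injective (_ ◅ p) (new , _)  fzero    (fsuc j) x≈v = contradiction x≈v (vertex-All p new j)
  vertex-injective (_ ◅ p) (new , _)  (fsuc i) fzero    v≈x = contradiction (≈-sym v≈x) (vertex-All p new i)
  vertex-injective (_ ◅ p) (_ , d)    (fsuc i) (fsuc j) v≈v = cong fsuc (vertex-injective p d i j v≈v)

  vertex-first : ∀ {x} (p : Walk E x) → vertex p fzero ≡ x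
  vertex-first stop    = refl
  vertex-first (_ ◅ p) = refl

  vertex-last : ∀ {x} (p : Walk E x) → vertex p (fromℕ (steps p)) ≡ end p
  vertex-last stop    = refl
  vertex-last (_ ◅ p) = vertex-last p

  vertex-step : ∀ {x} (p : Walk E x) (i : Fin (steps p)) → E (vertex p (inject₁ i)) (vertex p (fsuc i))
  vertex-step (_◅_ {x} e p) fzero    = subst (E x) (≡-sym (vertex-first p)) e
  vertex-step (_ ◅ p)       (fsuc i) = vertex-step p i

  closing-edge⇒Cycle : ∀ {H x} → E ⊆ H → (p : Walk E x) → Distinct p → 2 ≤ steps p → H (end p) x → Cycle H
  closing-edge⇒Cycle {H} E⊆H p d 2≤steps closing =
    steps p , vertex p , 2≤steps , vertex-injective p d , (λ i → E⊆H _ _ (vertex-step p i)) ,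
    subst₂ H (≡-sym (vertex-last p)) (≡-sym (vertex-first p)) closing

AgreeFrom-mono : ∀ {m n x y} → m ≤ n → AgreeFrom m x y → AgreeFrom n x y
AgreeFrom-mono m≤n x≈y i n≤i = x≈y i (≤-trans m≤n n≤i)

AgreeFrom-step : ∀ {n x y} → x n ≡ y n → AgreeFrom (suc n) x y → AgreeFrom n x y
AgreeFrom-step xn≡yn x≈y i n≤i with m≤n⇒m<n∨m≡n n≤i
... | inj₁ n<i  = x≈y i n<i
... | inj₂ refl = xn≡yn

opposite-bits⇒≉ : ∀ {x y i c} → x i ≡ c → y i ≡ not c → ¬ x ≈ y
opposite-bits⇒≉ {i = i} xi≡c yi≡¬c x≈y = not-¬ refl (trans (≡-sym xi≡c) (trans (x≈y i) yi≡¬c))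

splice : ℕ → Bool → Cantor → Cantor
splice L c A = branch L c (λ k → A (suc (L + k)))

splice-above : ∀ L c A → AgreeFrom (suc L) (splice L c A) A
splice-above L c A i L<i with m≤n⇒∃[o]m+o≡n L<i
... | k , refl = branch-> L c _ k

splice-rung : ∀ L c A → sym Link (cons c (splice L c A)) (cons (not c) (splice L (not c) A))
splice-rung L false A = inj₁ (refl , refl , inj₂ (𝔾₀-branch L _))
splice-rung L true  A = inj₂ (refl , refl , inj₂ (𝔾₀-branch L _))

record LinkPath (L : ℕ) (a : Bool) (A target : Cantor) : Set where
  field
    walk        : Walk (sym Link) (cons a A)
    reaches     : end walk ≈ target
    distinct    : Distinct walk
    agree-above : AllVertices (λ v → AgreeFrom L (tail v) A) walk
open LinkPath

widen : ∀ {L a A t} → LinkPath L a A t → LinkPath (suc L) a A t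
widen P = record
  { walk        = walk P
  ; reaches     = reaches P
  ; distinct    = distinct P
  ; agree-above = All-map (walk P) (AgreeFrom-mono (n≤1+n _)) (agree-above P)
  }

rung : ∀ {a b A B} → a ≢ b → A ≈ B → sym Link (cons a A) (cons b B)
rung {false} {false} a≢b _   = contradiction refl a≢b
rung {false} {true}  _   A≈B = inj₁ (refl , refl , inj₁ A≈B)
rung {true}  {false} _   A≈B = inj₂ (refl , refl , inj₁ (≈-sym A≈B))
rung {true}  {true}  a≢b _   = contradiction refl a≢b

link-path : ∀ L a b A B → AgreeFrom L A B → LinkPath L a A (cons b B)
bridge : ∀ L c a b A B → A L ≡ c → B L ≡ not c → AgreeFrom (suc L) A B → LinkPath (suc L) a A (cons b B)

link-path zero a b A B A≈B with a ≟ b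
... | yes refl = record
  { walk        = stop
  ; reaches     = cons-cong refl (λ i → A≈B i z≤n)
  ; distinct    = tt
  ; agree-above = λ _ _ → refl
  }
... | no a≢b   = record
  { walk        = rung a≢b (λ i → A≈B i z≤n) ◅ stop
  ; reaches     = ≈-refl
  ; distinct    = (λ a≈b → a≢b (a≈b 0)) , tt
  ; agree-above = (λ _ _ → refl) , λ i _ → ≡-sym (A≈B i z≤n)
  }
link-path (suc L) a b A B A≈B with A L ≟ B L
... | yes AL≡BL = widen (link-path L a b A B (AgreeFrom-step AL≡BL A≈B))
... | no AL≢BL  = bridge L (A L) a b A B refl (¬-not (≢-sym AL≢BL)) A≈B

-- A and B agree above L and differ at L: pass through the 𝔾₀-edge at level L whose tail is that
-- of A; the two halves are disjoint because their vertices differ at coordinate L.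
bridge L c a b A B AL≡c BL≡¬c A≈B = record
  { walk        = join (walk P) e (walk Q)
  ; reaches     = subst (_≈ cons b B) (≡-sym (end-join (walk P) e (walk Q))) (reaches Q)
  ; distinct    = Distinct-join (walk P) e (walk Q) (distinct P) (distinct Q) separated
  ; agree-above = All-join (walk P) e (walk Q)
                    (All-map (walk P) (AgreeFrom-mono (n≤1+n L)) (agree-above P))
                    (All-map (walk Q) (λ v≈Y i L<i → trans (v≈Y i (<⇒≤ L<i)) (splice-above L (not c) A i L<i)) (agree-above Q))
  }
  where
  X Y : Cantor
  X = splice L c A
  Y = splice L (not c) A
  P : LinkPath L a A (cons c X)
  P = link-path L a c A X (AgreeFrom-step (trans AL≡c (≡-sym (branch-at L c _))) (λ i L<i → ≡-sym (splice-above L c A i L<i)))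
  Q : LinkPath L (not c) Y (cons b B)
  Q = link-path L (not c) b Y B (AgreeFrom-step (trans (branch-at L (not c) _) (≡-sym BL≡¬c))
                                              (λ i L<i → trans (splice-above L (not c) A i L<i) (A≈B i L<i)))
  e : sym Link (end (walk P)) (cons (not c) Y)
  e = sym-Link-respˡ {x′ = cons c X} {y = cons (not c) Y} (reaches P) (splice-rung L c A)
  separated : AllVertices (λ u → AllVertices (λ v → ¬ u ≈ v) (walk Q)) (walk P)
  separated = All-map (walk P) (λ u≈A → All-map (walk Q) (λ v≈Y →
    opposite-bits⇒≉ (trans (u≈A L ≤-refl) AL≡c) (trans (v≈Y L ≤-refl) (branch-at L (not c) _))) (agree-above Q)) (agree-above P)

module _ {H : Rel} (H-sym : ∀ x y → H x y → H y x) (H-respˡ : ∀ {x x′ y} → x ≈ x′ → H x′ y → H x y)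
         (H-acyclic : acyclic H) (Link⊆H : Link ⊆ H) where

  sym-Link⊆H : sym Link ⊆ H
  sym-Link⊆H x y (inj₁ xy) = Link⊆H x y xy
  sym-Link⊆H x y (inj₂ yx) = H-sym y x (Link⊆H y x yx)

  closing-walk : ∀ {A B} (p : Walk (sym Link) (cons true B)) → end p ≈ cons false A → Distinct p →
                 H (cons false A) (cons true B) → 𝔾₀ᵣ A B
  closing-walk stop                      reaches _ _ = contradiction (reaches 0) λ ()
  closing-walk (inj₁ (t≡f , _) ◅ stop)   _       _ _ = contradiction t≡f λ ()
  closing-walk (inj₂ (_ , _ , r) ◅ stop) reaches _ _ = 𝔾₀ᵣ-resp (tail-cong reaches) ≈-refl r
  closing-walk p@(_ ◅ _ ◅ _)             reaches d h =
    ⊥-elim (H-acyclic (closing-edge⇒Cycle sym-Link⊆H p d (s≤s (s≤s z≤n)) (H-respˡ reaches h)))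

  edge⇒𝔾₀ᵣ : ∀ L {A B} → AgreeFrom L A B → H (cons false A) (cons true B) → 𝔾₀ᵣ A B
  edge⇒𝔾₀ᵣ L {A} {B} A≈B h = closing-walk (walk P) (reaches P) (distinct P) h
    where
    P : LinkPath L true B (cons false A)
    P = link-path L true false B A (λ i L≤i → ≡-sym (A≈B i L≤i))

preimage : ℕ → (ℕ → ℕ) → ℕ → Maybe ℕ
preimage zero    p i = nothing
preimage (suc k) p i with p k ≟ℕ i
... | yes _ = just k
... | no  _ = preimage k p i

preimage-just : ∀ k p i {j} → preimage k p i ≡ just j → j < k × p j ≡ i
preimage-just (suc k) p i eq with p k ≟ℕ i
preimage-just (suc k) p i refl | yes pk≡i = ≤-refl , pk≡i
... | no _ = map₁ m<n⇒m<1+n (preimage-just k p i eq)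

preimage-nothing : ∀ k p i → preimage k p i ≡ nothing → ∀ j → j < k → p j ≢ i
preimage-nothing (suc k) p i eq j j<1+k pj≡i with p k ≟ℕ i
preimage-nothing (suc k) p i () j j<1+k pj≡i | yes _
... | no pk≢i with m≤n⇒m<n∨m≡n (s≤s⁻¹ j<1+k)
...   | inj₁ j<k  = preimage-nothing k p i eq j j<k pj≡i
...   | inj₂ refl = pk≢i pj≡i

preimage-cong : ∀ k {p q} i → (∀ j → j < k → p j ≡ q j) → preimage k p i ≡ preimage k q i
preimage-cong zero    i p≡q = refl
preimage-cong (suc k) {p} {q} i p≡q with p k ≟ℕ i | q k ≟ℕ i
... | yes _    | yes _    = refl
... | yes pk≡i | no  qk≢i = contradiction (trans (≡-sym (p≡q k ≤-refl)) pk≡i) qk≢i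
... | no  pk≢i | yes qk≡i = contradiction (trans (p≡q k ≤-refl) qk≡i) pk≢i
... | no  _    | no  _    = preimage-cong k i (λ j j<k → p≡q j (m<n⇒m<1+n j<k))

spread : ℕ → (ℕ → ℕ) → Cantor → Cantor
spread k p t i = maybe′ t false (preimage k p i)

spread-view : ∀ k p i → (Σ ℕ λ j → j < k × p j ≡ i × ∀ t → spread k p t i ≡ t j)
                      ⊎ ((∀ j → j < k → p j ≢ i) × ∀ t → spread k p t i ≡ false)
spread-view k p i with preimage k p i in eq
... | just j  = inj₁ (j , proj₁ (preimage-just k p i eq) , proj₂ (preimage-just k p i eq) , λ t → refl)
... | nothing = inj₂ (preimage-nothing k p i eq , λ t → refl)

spread-hit : ∀ k {p} → (∀ {j j′} → p j ≡ p j′ → j ≡ j′) → ∀ t {j} → j < k → spread k p t (p j) ≡ t j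
spread-hit k {p} p-injective t {j} j<k with spread-view k p (p j)
... | inj₁ (j′ , _ , pj′≡pj , spread≡) = trans (spread≡ t) (cong t (p-injective pj′≡pj))
... | inj₂ (miss , _)                 = contradiction refl (miss j j<k)

spread-miss : ∀ k p t {i} → (∀ j → j < k → p j ≢ i) → spread k p t i ≡ false
spread-miss k p t {i} ∉p with spread-view k p i
... | inj₁ (j , j<k , pj≡i , _) = contradiction pj≡i (∉p j j<k)
... | inj₂ (_ , spread≡)         = spread≡ t

spread-congˡ : ∀ k {p q} t → (∀ j → j < k → p j ≡ q j) → spread k p t ≈ spread k q t
spread-congˡ k t p≡q i = cong (maybe′ t false) (preimage-cong k i p≡q)

spread-congʳ : ∀ k p {t u} → Agree k t u → spread k p t ≈ spread k p u
spread-congʳ k p {t} {u} t≈u i with spread-view k p i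
... | inj₁ (j , j<k , _ , spread≡) = trans (spread≡ t) (trans (t≈u j j<k) (≡-sym (spread≡ u)))
... | inj₂ (_ , spread≡)           = trans (spread≡ t) (≡-sym (spread≡ u))

maxOver : ℕ → (List Bool → ℕ) → ℕ
maxOver zero    f = f []
maxOver (suc k) f = maxOver k (f ∘ (false ∷_)) ⊔ maxOver k (f ∘ (true ∷_))

prefix-≤-maxOver : ∀ k f x → f (prefix k x) ≤ maxOver k f
prefix-≤-maxOver zero    f x = ≤-refl
prefix-≤-maxOver (suc k) f x with x 0
... | false = ≤-trans (prefix-≤-maxOver k (f ∘ (false ∷_)) (tail x)) (m≤m⊔n _ _)
... | true  = ≤-trans (prefix-≤-maxOver k (f ∘ (true ∷_)) (tail x)) (m≤n⊔m _ _)

module _ {f : ℕ → ℕ} (f-suc : ∀ k → f k < f (suc k)) where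

  strictly-increasing : ∀ {j k} → j < k → f j < f k
  strictly-increasing {j} {suc k} j<1+k with m≤n⇒m<n∨m≡n (s≤s⁻¹ j<1+k)
  ... | inj₁ j<k  = <-trans (strictly-increasing j<k) (f-suc k)
  ... | inj₂ refl = f-suc k

  strictly-increasing-≤ : ∀ {j k} → j ≤ k → f j ≤ f k
  strictly-increasing-≤ j≤k with m≤n⇒m<n∨m≡n j≤k
  ... | inj₁ j<k  = <⇒≤ (strictly-increasing j<k)
  ... | inj₂ refl = ≤-refl

  strictly-increasing⁻¹ : ∀ {j k} → f j < f k → j < k
  strictly-increasing⁻¹ {j} {k} fj<fk with <-cmp j k
  ... | tri< j<k _ _    = j<k
  ... | tri≈ _ refl _   = contradiction fj<fk (<-irrefl refl)
  ... | tri> _ _ k<j    = contradiction fj<fk (<-asym (strictly-increasing k<j))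

  strictly-increasing-injective : ∀ {j k} → f j ≡ f k → j ≡ k
  strictly-increasing-injective {j} {k} fj≡fk with <-cmp j k
  ... | tri< j<k _ _ = contradiction fj≡fk (<⇒≢ (strictly-increasing j<k))
  ... | tri≈ _ j≡k _ = j≡k
  ... | tri> _ _ k<j = contradiction fj≡fk (≢-sym (<⇒≢ (strictly-increasing k<j)))

  strictly-increasing-inflationary : ∀ k → k ≤ f k
  strictly-increasing-inflationary zero    = z≤n
  strictly-increasing-inflationary (suc k) = <-≤-trans (s≤s (strictly-increasing-inflationary k)) (f-suc k)

module Embedding (em : ExcludedMiddle 0ℓ) {H : Rel} (H-closed : Closed H) where

  bound : ℕ → (ℕ → ℕ) → ℕ
  bound zero    p = 0
  bound (suc k) p = suc (p k)

  -- Enough zeros after the image of s_k to isolate, by closedness, every non-edge between images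
  -- of words of length k.
  margin : ℕ → (ℕ → ℕ) → ℕ
  margin k p = maxOver k λ u → maxOver k λ v →
    radius em H-closed (cons false (spread k p (pad u))) (cons true (spread k p (pad v)))

  code : ℕ → (ℕ → ℕ) → List Bool
  code k p = prefix (bound k p) (spread k p (ŝ k)) ++ replicate (margin k p) false

  length-code : ∀ k p → length (code k p) ≡ bound k p + margin k p
  length-code k p = trans (length-++ (prefix (bound k p) _)) (cong₂ _+_ (length-prefix (bound k p) _) (length-replicate (margin k p)))

  -- π↾ k j = π j for j < k (course-of-values recursion; junk for j ≥ k).  Opaque, since unfolding
  -- π into binary arithmetic makes conversion checking blow up.
  opaque
    π↾ : ℕ → ℕ → ℕ
    π↾ zero    j = 0
    π↾ (suc k) j with j <? k
    ... | yes _ = π↾ k j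
    ... | no  _ = ψ⁻¹ (code k (π↾ k))

    π : ℕ → ℕ
    π k = ψ⁻¹ (code k (π↾ k))

    π↾-π : ∀ k {j} → j < k → π↾ k j ≡ π j
    π↾-π (suc k) {j} j<1+k with j <? k
    ... | yes j<k = π↾-π k j<k
    ... | no  j≮k with m≤n⇒m<n∨m≡n (s≤s⁻¹ j<1+k)
    ...   | inj₁ j<k  = contradiction j<k j≮k
    ...   | inj₂ refl = refl

    ψ-π : ∀ k → ψ (π k) ≡ code k (π↾ k)
    ψ-π k = ψ-ψ⁻¹ (code k (π↾ k))

    bound+margin≤π : ∀ k → bound k (π↾ k) + margin k (π↾ k) ≤ π k
    bound+margin≤π k = subst (_≤ π k) (length-code k (π↾ k)) (length≤ψ⁻¹ (code k (π↾ k)))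

  π-suc : ∀ k → π k < π (suc k)
  π-suc k = subst (λ m → suc m ≤ π (suc k)) (π↾-π (suc k) ≤-refl) (≤-trans (m≤m+n _ _) (bound+margin≤π (suc k)))

  π-increasing : ∀ {j k} → j < k → π j < π k
  π-increasing = strictly-increasing π-suc

  π-injective : ∀ {j k} → π j ≡ π k → j ≡ k
  π-injective = strictly-increasing-injective π-suc

  π<bound : ∀ k {j} → j < k → π j < bound k (π↾ k)
  π<bound (suc k) {j} j<1+k = subst (λ m → π j < suc m) (≡-sym (π↾-π (suc k) ≤-refl))
                                      (s≤s (strictly-increasing-≤ π-suc (s≤s⁻¹ j<1+k)))

  margin≤π : ∀ k → margin k (π↾ k) ≤ π k
  margin≤π k = ≤-trans (m≤n+m _ _) (bound+margin≤π k)

  spread-π↾ : ∀ k t → spread k (π↾ k) t ≈ spread k π t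
  spread-π↾ k t = spread-congˡ k t (λ j → π↾-π k)

  spread-beyond : ∀ k t → AgreeFrom (bound k (π↾ k)) (spread k π t) zeros
  spread-beyond k t i bound≤i = spread-miss k π t (λ j j<k πj≡i → <⇒≢ (<-≤-trans (π<bound k j<k) bound≤i) πj≡i)

  ŝ-π : ∀ k → ŝ (π k) ≈ spread k π (ŝ k)
  ŝ-π k i = begin
    pad (sₙ (π k)) i                      ≡⟨ pad-++-zeros (ψ (π k)) _ i ⟩
    pad (ψ (π k)) i                       ≡⟨ cong (λ w → pad w i) (ψ-π k) ⟩
    pad (code k (π↾ k)) i                 ≡⟨ pad-++-zeros (prefix b _) (margin k (π↾ k)) i ⟩
    pad (prefix b (spread k (π↾ k) (ŝ k))) i ≡⟨ cong (λ w → pad w i) (prefix-cong b (spread-π↾ k (ŝ k))) ⟩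
    pad (prefix b (spread k π (ŝ k))) i    ≡⟨ pad-prefix b _ (spread-beyond k (ŝ k)) i ⟩
    spread k π (ŝ k) i                    ∎
    where
    open ≡-Reasoning
    b = bound k (π↾ k)

  -- Only j ≤ i can satisfy π j ≡ i, because j ≤ π j.
  g : Cantor → Cantor
  g x i = spread (suc i) π x i

  g-view : ∀ i → (Σ ℕ λ j → π j ≡ i × ∀ x → g x i ≡ x j) ⊎ ((∀ j → π j ≢ i) × ∀ x → g x i ≡ false)
  g-view i with spread-view (suc i) π i
  ... | inj₁ (j , _ , πj≡i , g≡) = inj₁ (j , πj≡i , g≡)
  ... | inj₂ (miss , g≡)         = inj₂ (miss′ , g≡)
    where
    miss′ : ∀ j → π j ≢ i
    miss′ j πj≡i = miss j (s≤s (subst (j ≤_) πj≡i (strictly-increasing-inflationary π-suc j))) πj≡i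

  g-π : ∀ x j → g x (π j) ≡ x j
  g-π x j = spread-hit (suc (π j)) π-injective x (s≤s (strictly-increasing-inflationary π-suc j))

  g-local : ∀ {x y} i → Agree (suc i) x y → g x i ≡ g y i
  g-local i x≈y = spread-congʳ (suc i) π x≈y i

  g-spread : ∀ k x {i} → i < π k → g x i ≡ spread k π x i
  g-spread k x {i} i<πk with g-view i
  ... | inj₁ (j , refl , g≡) = trans (g≡ x) (≡-sym (spread-hit k π-injective x (strictly-increasing⁻¹ π-suc i<πk)))
  ... | inj₂ (miss , g≡)     = trans (g≡ x) (≡-sym (spread-miss k π x (λ j _ → miss j)))

  g-𝔾₀-at : ∀ {n α β} → 𝔾₀-at n α β → 𝔾₀-at (π n) (g α) (g β)
  g-𝔾₀-at {n} {α} {β} G = record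
    { left-bit  = trans (g-π α n) left-bit
    ; right-bit = trans (g-π β n) right-bit
    ; agree-off = agree-off′
    ; below     = below′
    }
    where
    open 𝔾₀-at G
    agree-off′ : ∀ i → i ≢ π n → g α i ≡ g β i
    agree-off′ i i≢πn with g-view i
    ... | inj₁ (j , refl , g≡) = trans (g≡ α) (trans (agree-off j (i≢πn ∘ cong π)) (≡-sym (g≡ β)))
    ... | inj₂ (_ , g≡)        = trans (g≡ α) (≡-sym (g≡ β))
    below′ : Agree (π n) (g α) (ŝ (π n))
    below′ i i<πn = begin
      g α i                 ≡⟨ g-spread n α i<πn ⟩
      spread n π α i        ≡⟨ spread-congʳ n π below i ⟩
      spread n π (ŝ n) i    ≡⟨ ≡-sym (ŝ-π n i) ⟩
      ŝ (π n) i             ∎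
      where open ≡-Reasoning

  g-𝔾₀-at⁻¹ : ∀ {m α β} → 𝔾₀-at m (g α) (g β) → 𝔾₀ α β
  g-𝔾₀-at⁻¹ {m} {α} {β} G with g-view m
  ... | inj₂ (_ , g≡)        = contradiction (trans (≡-sym (g≡ β)) right-bit) λ ()
    where open 𝔾₀-at G
  ... | inj₁ (n , refl , g≡) = 𝔾₀-at⇒𝔾₀ {n} record
    { left-bit  = trans (≡-sym (g≡ α)) left-bit
    ; right-bit = trans (≡-sym (g≡ β)) right-bit
    ; agree-off = λ i i≢n → trans (≡-sym (g-π α i)) (trans (agree-off (π i) (i≢n ∘ π-injective)) (g-π β i))
    ; below     = below′
    }
    where
    open 𝔾₀-at G
    below′ : Agree n α (ŝ n)
    below′ i i<n = begin
      α i                 ≡⟨ ≡-sym (g-π α i) ⟩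
      g α (π i)           ≡⟨ below (π i) (π-increasing i<n) ⟩
      ŝ (π n) (π i)       ≡⟨ ŝ-π n (π i) ⟩
      spread n π (ŝ n) (π i) ≡⟨ spread-hit n π-injective (ŝ n) i<n ⟩
      ŝ n i               ∎
      where open ≡-Reasoning

  g-𝔾₀ : ∀ {α β} → 𝔾₀ α β → 𝔾₀ (g α) (g β)
  g-𝔾₀ G = 𝔾₀-at⇒𝔾₀ (g-𝔾₀-at (proj₂ (𝔾₀⇒𝔾₀-at G)))

  g-𝔾₀⁻¹ : ∀ {α β} → 𝔾₀ (g α) (g β) → 𝔾₀ α β
  g-𝔾₀⁻¹ G = g-𝔾₀-at⁻¹ (proj₂ (𝔾₀⇒𝔾₀-at G))

  approx : ℕ → Cantor → Cantor
  approx k x = spread k (π↾ k) (pad (prefix k x))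

  approx-π : ∀ k x {j} → j < k → approx k x (π j) ≡ x j
  approx-π k x {j} j<k =
    trans (spread-π↾ k _ (π j)) (trans (spread-hit k π-injective _ j<k) (prepend-prefix k x zeros j<k))

  approx-beyond : ∀ k x → AgreeFrom (bound k (π↾ k)) (approx k x) zeros
  approx-beyond k x i bound≤i = trans (spread-π↾ k _ i) (spread-beyond k _ i bound≤i)

  approx-g : ∀ k x → Agree (π k) (approx k x) (g x)
  approx-g k x i i<πk = begin
    spread k (π↾ k) (pad (prefix k x)) i  ≡⟨ spread-π↾ k _ i ⟩
    spread k π (pad (prefix k x)) i       ≡⟨ spread-congʳ k π (λ j → prepend-prefix k x zeros) i ⟩
    spread k π x i                        ≡⟨ ≡-sym (g-spread k x i<πk) ⟩
    g x i                                 ∎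
    where open ≡-Reasoning

  radius-approx≤π : ∀ k α β → radius em H-closed (cons false (approx k α)) (cons true (approx k β)) ≤ π k
  radius-approx≤π k α β = begin
    ρ (prefix k α) (prefix k β)          ≤⟨ prefix-≤-maxOver k (ρ (prefix k α)) β ⟩
    maxOver k (ρ (prefix k α))           ≤⟨ prefix-≤-maxOver k (maxOver k ∘ ρ) α ⟩
    margin k (π↾ k)                      ≤⟨ margin≤π k ⟩
    π k                                  ∎
    where
    open ≤-Reasoning
    ρ : List Bool → List Bool → ℕ
    ρ u v = radius em H-closed (cons false (spread k (π↾ k) (pad u))) (cons true (spread k (π↾ k) (pad v)))

  ¬H-approx⇒¬H-g : ∀ k α β → ¬ H (cons false (approx k α)) (cons true (approx k β)) →
                   ¬ H (cons false (g α)) (cons true (g β))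
  ¬H-approx⇒¬H-g k α β ¬H = radius-isolates em H-closed ¬H _ _ (close α false) (close β true)
    where
    close : ∀ x b → Agree _ (cons b (approx k x)) (cons b (g x))
    close x b = Agree-mono (≤-trans (radius-approx≤π k α β) (n≤1+n (π k))) (Agree-cons b (approx-g k x))

TwoDifferences : Cantor → Cantor → Set
TwoDifferences α β = Σ ℕ λ j₁ → Σ ℕ λ j₂ → j₁ < j₂ × α j₁ ≢ β j₁ × α j₂ ≢ β j₂

module Reduction (em : ExcludedMiddle 0ℓ) {H : Rel} (H-closed : Closed H) (H-sym : ∀ x y → H x y → H y x)
                 (H-acyclic : acyclic H) (𝔹₀⊆H : 𝔹₀ ⊆ H) where
  open Embedding em H-closed

  Link⊆H : Link ⊆ H
  Link⊆H x y xy = closure⊆closed em H-closed 𝔹₀⊆H x y (Link⊆closure-𝔹₀ x y xy)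

  H-edge⇒𝔾₀ᵣ : ∀ L {A B} → AgreeFrom L A B → H (cons false A) (cons true B) → 𝔾₀ᵣ A B
  H-edge⇒𝔾₀ᵣ = edge⇒𝔾₀ᵣ H-sym (λ x≈x′ → closed-resp em H-closed (≈-sym x≈x′) ≈-refl) H-acyclic Link⊆H

  two-differences⇒¬H : ∀ {α β} → TwoDifferences α β → ¬ H (cons false (g α)) (cons true (g β))
  two-differences⇒¬H {α} {β} (j₁ , j₂ , j₁<j₂ , d₁ , d₂) = ¬H-approx⇒¬H-g k α β ¬H
    where
    k = suc j₂
    j₁<k : j₁ < k
    j₁<k = <-trans j₁<j₂ (n<1+n j₂)
    approx-differs : ∀ {j} → j < k → α j ≢ β j → approx k α (π j) ≢ approx k β (π j)
    approx-differs j<k d A≡B = d (trans (≡-sym (approx-π k α j<k)) (trans A≡B (approx-π k β j<k)))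
    ¬H : ¬ H (cons false (approx k α)) (cons true (approx k β))
    eventually-equal : AgreeFrom (bound k (π↾ k)) (approx k α) (approx k β)
    eventually-equal i b≤i = trans (approx-beyond k α i b≤i) (≡-sym (approx-beyond k β i b≤i))
    ¬H h with H-edge⇒𝔾₀ᵣ (bound k (π↾ k)) eventually-equal h
    ... | inj₁ A≈B = approx-differs j₁<k d₁ (A≈B (π j₁))
    ... | inj₂ G with 𝔾₀⇒𝔾₀-at G
    ... | n , G′ = <⇒≢ j₁<j₂ (π-injective (trans (𝔾₀-at-difference G′ (approx-differs j₁<k d₁))
                                                (≡-sym (𝔾₀-at-difference G′ (approx-differs ≤-refl d₂)))))

  g-agree-beyond-difference : ∀ {α β j} → ¬ TwoDifferences α β → α j ≢ β j → AgreeFrom (suc (π j)) (g α) (g β)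
  g-agree-beyond-difference {α} {β} {j} ¬two d i πj<i with g-view i
  ... | inj₂ (_ , g≡)        = trans (g≡ α) (≡-sym (g≡ β))
  ... | inj₁ (j′ , refl , g≡) with α j′ ≟ β j′
  ...   | yes αj′≡βj′ = trans (g≡ α) (trans αj′≡βj′ (≡-sym (g≡ β)))
  ...   | no  d′      = contradiction (j , j′ , strictly-increasing⁻¹ π-suc πj<i , d , d′) ¬two

  H-g⇒𝔾₀ᵣ : ∀ {α β} → H (cons false (g α)) (cons true (g β)) → 𝔾₀ᵣ α β
  H-g⇒𝔾₀ᵣ {α} {β} h with em {TwoDifferences α β}
  ... | yes two  = contradiction h (two-differences⇒¬H two)
  ... | no  ¬two with em {Σ ℕ λ j → α j ≢ β j}
  ...   | no  ¬one    = inj₁ λ j → decidable-stable (α j ≟ β j) (λ d → ¬one (j , d))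
  ...   | yes (j , d) with H-edge⇒𝔾₀ᵣ (suc (π j)) (g-agree-beyond-difference ¬two d) h
  ...     | inj₁ gα≈gβ = contradiction (trans (≡-sym (g-π α j)) (trans (gα≈gβ (π j)) (g-π β j))) d
  ...     | inj₂ G     = inj₂ (g-𝔾₀⁻¹ G)

  f : Cantor → Cantor
  f x = cons (x 0) (g (tail x))

  f-injective : Injective f
  f-injective x y fx≈fy zero    = fx≈fy 0
  f-injective x y fx≈fy (suc j) = trans (≡-sym (g-π (tail x) j)) (trans (fx≈fy (suc (π j))) (g-π (tail y) j))

  f-Agree : ∀ n {x y} → Agree n x y → Agree n (f x) (f y)
  f-Agree n x≈y zero    0<n   = x≈y 0 0<n
  f-Agree n x≈y (suc i) 1+i<n = g-local i (λ j j<1+i → x≈y (suc j) (≤-trans (s≤s j<1+i) 1+i<n))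

  f-continuous : Continuous f
  f-continuous x n = n , λ y → f-Agree n

  f-𝔹₀ : MapsInto f 𝔹₀ 𝔹₀
  f-𝔹₀ x y xy with 𝔹₀⇒Across x y xy
  ... | x0 , y0 , G = Across⇒𝔹₀ (f x) (f y) (x0 , y0 , g-𝔾₀ G)

  f-𝔹₀⁻¹ : ∀ x y → 𝔹₀ (f x) (f y) → 𝔹₀ x y
  f-𝔹₀⁻¹ x y fxfy with 𝔹₀⇒Across (f x) (f y) fxfy
  ... | x0 , y0 , G = Across⇒𝔹₀ x y (x0 , y0 , g-𝔾₀⁻¹ G)

  f-closure : MapsInto f (closure 𝔹₀) (closure 𝔹₀)
  f-closure x y x̄ȳ n with x̄ȳ n
  ... | x′ , y′ , x′y′ , x≈ , y≈ = f x′ , f y′ , f-𝔹₀ x′ y′ x′y′ , f-Agree n x≈ , f-Agree n y≈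

  f-closure∖𝔹₀ : MapsInto f (closure 𝔹₀ ∖ 𝔹₀) (closure 𝔹₀ ∖ 𝔹₀)
  f-closure∖𝔹₀ x y (x̄ȳ , ¬xy) = f-closure x y x̄ȳ , ¬xy ∘ f-𝔹₀⁻¹ x y

  H-f⇒closure : ∀ x y → x 0 ≡ false → y 0 ≡ true → H (f x) (f y) → closure 𝔹₀ x y
  H-f⇒closure x y x0 y0 h =
    Link⊆closure-𝔹₀ x y (x0 , y0 , H-g⇒𝔾₀ᵣ (closed-resp em H-closed (cons-cong x0 ≈-refl) (cons-cong y0 ≈-refl) h))

𝔹₀-Reduction : Rel → Rel → Set
𝔹₀-Reduction E F = Σ (Cantor → Cantor) λ f → Injective f × Continuous f ×
  MapsInto f 𝔹₀ 𝔹₀ × MapsInto f (closure 𝔹₀ ∖ 𝔹₀) (closure 𝔹₀ ∖ 𝔹₀) × MapsInto f (∁ E) (∁ F)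

oriented-case : ExcludedMiddle 0ℓ → ∀ F → Closed F → 𝔹₀ ⊆ F → F ⊆ ((N0 ⊠ N1) ∪ (N1 ⊠ N0)) →
                IsOrientedGraph F × Acyclic F → 𝔹₀-Reduction (closure 𝔹₀) F
oriented-case em F F-closed 𝔹₀⊆F F⊆N ((_ , antisymmetric) , F-Acyclic) =
  f , f-injective , f-continuous , f-𝔹₀ , f-closure∖𝔹₀ , avoids
  where
  open Reduction em (closed-sym F-closed) (λ _ _ → swap) F-Acyclic (λ x y → inj₁ ∘ 𝔹₀⊆F x y)
  avoids : MapsInto f (∁ (closure 𝔹₀)) (∁ F)
  avoids x y ¬x̄ȳ Ffxfy with F⊆N (f x) (f y) Ffxfy
  ... | inj₁ (fx∈N0 , fy∈N1) = ¬x̄ȳ (H-f⇒closure x y (fx∈N0 fzero) (fy∈N1 fzero) (inj₁ Ffxfy))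
  ... | inj₂ (fx∈N1 , fy∈N0) =
    contradiction (antisymmetric (f x) (f y) Ffxfy Ffyfx) (opposite-bits⇒≉ {i = 0} (fx∈N1 fzero) (fy∈N0 fzero))
    where
    Ffyfx : F (f y) (f x)
    Ffyfx = closure⊆closed em F-closed 𝔹₀⊆F _ _ (f-closure y x (H-f⇒closure y x (fy∈N0 fzero) (fx∈N1 fzero) (inj₂ Ffxfy)))

graph-case : ExcludedMiddle 0ℓ → ∀ F → Closed F → 𝔹₀ ⊆ F → F ⊆ ((N0 ⊠ N1) ∪ (N1 ⊠ N0)) →
             IsGraph F × acyclic F → 𝔹₀-Reduction (sym (closure 𝔹₀)) F
graph-case em F F-closed 𝔹₀⊆F F⊆N ((_ , F-sym) , F-acyclic) =
  f , f-injective , f-continuous , f-𝔹₀ , f-closure∖𝔹₀ , avoids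
  where
  open Reduction em F-closed F-sym F-acyclic 𝔹₀⊆F
  avoids : MapsInto f (∁ (sym (closure 𝔹₀))) (∁ F)
  avoids x y ¬x̄ȳ Ffxfy with F⊆N (f x) (f y) Ffxfy
  ... | inj₁ (fx∈N0 , fy∈N1) = ¬x̄ȳ (inj₁ (H-f⇒closure x y (fx∈N0 fzero) (fy∈N1 fzero) Ffxfy))
  ... | inj₂ (fx∈N1 , fy∈N0) = ¬x̄ȳ (inj₂ (H-f⇒closure y x (fy∈N0 fzero) (fx∈N1 fzero) (F-sym _ _ Ffxfy)))

theorem4p11 : ExcludedMiddle 0ℓ →
    (F : Rel) → Closed F → 𝔹₀ ⊆ F → F ⊆ ((N0 ⊠ N1) ∪ (N1 ⊠ N0)) →
    ((IsOrientedGraph F × Acyclic F) →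
      Σ (Cantor → Cantor) λ f → Injective f × Continuous f ×
        MapsInto f 𝔹₀ 𝔹₀ ×
        MapsInto f (closure 𝔹₀ ∖ 𝔹₀) (closure 𝔹₀ ∖ 𝔹₀) ×
        MapsInto f (∁ (closure 𝔹₀)) (∁ F))
    ×
    ((IsGraph F × acyclic F) →
      Σ (Cantor → Cantor) λ f → Injective f × Continuous f ×
        MapsInto f 𝔹₀ 𝔹₀ ×
        MapsInto f (closure 𝔹₀ ∖ 𝔹₀) (closure 𝔹₀ ∖ 𝔹₀) ×
        MapsInto f (∁ (sym (closure 𝔹₀))) (∁ F))
theorem4p11 em F F-closed 𝔹₀⊆F F⊆N = oriented-case em F F-closed 𝔹₀⊆F F⊆N , graph-case em F F-closed 𝔹₀⊆F F⊆N
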